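{- Let $d$ be a positive integer, $a,b$ integers and $x_0$ real. If $\pi(x;d,a)\ge\pi(x;d,b)$ for all $x\le x_0$, then for all $x\le x_0$ we have $N(x;d,a)\ge N(x;d,b)$ and $\mu_{g_{d,a}}(x)\ge\mu_{g_{d,b}}(x)$.
   Context: $\pi(x;d,a)$ is the number of primes $p\le x$ with $p\equiv a\pmod d$. $g_{d,a}(n)=1$ if every prime divisor of $n$ is $\equiv a\pmod d$ (so $g_{d,a}(1)=1$) and $0$ otherwise; $N(x;d,a)=\sum_{n\le x}g_{d,a}(n)$ and $\mu_{g_{d,a}}(x)=\sum_{n\le x}g_{d,a}(n)/n$. -}

module Defs where

open import Data.Nat using (ℕ; zero; suc; _<_; _≤_; s≤s; z≤n)
open import Data.Nat.Properties using (allUpTo?)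
open import Data.Nat.Divisibility using (_∣?_; ∣⇒≤) renaming (_∣_ to _∣ℕ_)
open import Data.Nat.Primality using (Prime; prime?)
open import Data.Integer as ℤ using (ℤ; +_; _-_)
open import Data.Integer.Divisibility using () renaming (_∣_ to _∣ℤ_)
open import Data.Rational as ℚ using (ℚ; 0ℚ; _/_)
open import Data.List using (List; length; filter; upTo; map; foldr)
open import Data.Product using (_×_; _,_)
open import Relation.Nullary using (Dec; yes; no; ¬_)
open import Relation.Nullary.Decidable using (_×-dec_; _→-dec_; map′)
open import Relation.Unary using (Decidable)

Cong : ℕ → ℤ → ℕ → Set
Cong d a p = (+ d) ∣ℤ ((+ p) - a)

cong? : (d : ℕ) (a : ℤ) → Decidable (Cong d a)
cong? d a p = d ∣? ℤ.∣ (+ p) - a ∣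

primeCount : ℕ → ℤ → ℕ → ℕ
primeCount d a x = length (filter (λ p → prime? p ×-dec cong? d a p) (upTo (suc x)))

AllPrimeDivisorsCong : ℕ → ℤ → ℕ → Set
AllPrimeDivisorsCong d a n = ∀ p → Prime p → p ∣ℕ n → Cong d a p

-- decidability for n ≥ 1 (prime divisors of suc m are < suc (suc m))
allPrimeDivisorsCong? : (d : ℕ) (a : ℤ) (m : ℕ) → Dec (AllPrimeDivisorsCong d a (suc m))
allPrimeDivisorsCong? d a m =
  map′ to from (allUpTo? (λ p → (prime? p ×-dec p ∣? suc m) →-dec cong? d a p) (suc (suc m)))
  where
  to : (∀ {p} → p < suc (suc m) → (Prime p × p ∣ℕ suc m) → Cong d a p) → AllPrimeDivisorsCong d a (suc m)
  to h p pp p∣ = h (s≤s (∣⇒≤ p∣)) (pp , p∣)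
  from : AllPrimeDivisorsCong d a (suc m) → ∀ {p} → p < suc (suc m) → (Prime p × p ∣ℕ suc m) → Cong d a p
  from h {p} _ (pp , p∣) = h p pp p∣

-- g_{d,a}(n) as a 0/1 value, for n ≥ 1 (n = suc m)
g : ℕ → ℤ → ℕ → ℕ
g d a m with allPrimeDivisorsCong? d a m
... | yes _ = 1
... | no _  = 0

-- N(x;d,a) = Σ_{1 ≤ n ≤ x} g_{d,a}(n)
N : ℕ → ℤ → ℕ → ℕ
N d a x = foldr (λ m s → g d a m Data.Nat.+ s) 0 (upTo x)

-- μ_{g_{d,a}}(x) = Σ_{1 ≤ n ≤ x} g_{d,a}(n) / n   (in ℚ)
μg : ℕ → ℤ → ℕ → ℚ
μg d a x = foldr (λ m s → ((+ g d a m) / suc m) ℚ.+ s) 0ℚ (upTo x)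

-- If π(x;d,b) ≤ π(x;d,a) for all x ≤ X, then the r-th prime ≡ b (mod d) below X is at least the
-- r-th prime ≡ a (mod d).  Sending the r-th b-prime to the r-th a-prime and extending completely
-- multiplicatively maps every n ≤ x whose prime factors are all ≡ b to some number ≤ n whose prime
-- factors are all ≡ a, injectively by unique factorisation; hence N(x;d,b) ≤ N(x;d,a).  The bound
-- for μ follows by partial summation: since 1/n decreases, μ_b(x) + (N(x;d,a) − N(x;d,b))/x stays
-- below μ_a(x).
module Submission where

open import Defs
open import Data.Nat using (ℕ; _≤_; _<_)
open import Data.Integer using (ℤ)
open import Data.Rational using () renaming (_≤_ to _≤ℚ_)
open import Data.Product using (_×_)

open import Level using (0ℓ)
open import Function using (_∘_)
open import Algebra.Bundles using (Monoid)
open import Data.Nat using (zero; suc; pred; _+_; _∸_; _≤?_; z≤n; s≤s; z<s; NonZero)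
open import Data.Nat.Properties
open import Data.Nat.Divisibility using (_∣_; ∣⇒≤)
open import Data.Nat.Primality using (Prime; prime?; productOfPrimes≢0)
open import Data.Nat.Primality.Factorisation using (factorise; factorisationUnique; factorisationHasAllPrimeFactors; module PrimeFactorisation)
open import Data.Nat.ListAction using (product)
open import Data.Nat.ListAction.Properties using (product-↭; ∈⇒∣product)
open import Data.Integer as ℤ using (+_; +≤+)
import Data.Integer.Properties as ℤ
open import Data.Integer.Tactic.RingSolver using (solve-∀)
open import Data.Rational as ℚ using (ℚ; 0ℚ; _/_; toℚᵘ)
import Data.Rational.Properties as ℚ
open import Data.Rational.Unnormalised as ℚᵘ using (mkℚᵘ; *≡*; *≤*)
import Data.Rational.Unnormalised.Properties as ℚᵘ
open import Data.List using (List; []; _∷_; _++_; _∷ʳ_; [_]; map; length; filter; upTo; foldr)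
open import Data.List.Properties using (length-++; length-++-sucʳ; filter-++; filter-accept; filter-reject; upTo-∷ʳ; foldr-∷ʳ; map-∘; map-id-local)
open import Data.List.Membership.Propositional using (_∈_)
open import Data.List.Membership.Propositional.Properties using (∈-∃++; ∈-++⁻; ∈-++⁺ˡ; ∈-++⁺ʳ; ∈-map⁻; ∈-filter⁺; ∈-filter⁻; ∈-upTo⁺; ∈-upTo⁻)
open import Data.List.Relation.Unary.All as All using (All; []; _∷_)
import Data.List.Relation.Unary.All.Properties as All
open import Data.List.Relation.Unary.Any using (here; there)
open import Data.List.Relation.Unary.AllPairs using (_∷_)
open import Data.List.Relation.Unary.Unique.Propositional using (Unique)
import Data.List.Relation.Unary.Unique.Propositional.Properties as Unique
open import Data.List.Relation.Binary.Permutation.Propositional using (_↭_)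
import Data.List.Relation.Binary.Permutation.Propositional.Properties as ↭
open import Data.Product using (_,_; proj₁; proj₂)
open import Data.Sum using (inj₁; inj₂)
open import Relation.Nullary using (yes; no; ¬_; contradiction)
open import Relation.Unary using (Pred; Decidable; _∩_)
open import Relation.Unary.Properties using (_∩?_)
open import Relation.Binary.PropositionalEquality using (_≡_; refl; sym; trans; cong; subst; subst₂; module ≡-Reasoning)

length-≤-injection : {A B : Set} (f : A → B) {xs : List A} {ys : List B} → Unique xs
  → (∀ {u v} → u ∈ xs → v ∈ xs → f u ≡ f v → u ≡ v)
  → (∀ {u} → u ∈ xs → f u ∈ ys)
  → length xs ≤ length ys
length-≤-injection f {[]} _ _ _ = z≤n
length-≤-injection f {x ∷ xs} (x∉xs ∷ unique) injective into
  with us , ws , refl ← ∈-∃++ (into (here refl)) =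
  subst (suc (length xs) ≤_) (sym (length-++-sucʳ us (f x) ws))
    (s≤s (length-≤-injection f unique (λ u∈ v∈ → injective (there u∈) (there v∈)) into-rest))
  where
  into-rest : ∀ {u} → u ∈ xs → f u ∈ us ++ ws
  into-rest u∈ with ∈-++⁻ us (into (there u∈))
  ... | inj₁ fu∈us = ∈-++⁺ˡ fu∈us
  ... | inj₂ (here fu≡fx) = contradiction (sym (injective (there u∈) (here refl) fu≡fx)) (All.lookup x∉xs u∈)
  ... | inj₂ (there fu∈ws) = ∈-++⁺ʳ us fu∈ws

module _ {Q : Pred ℕ 0ℓ} (Q? : Decidable Q) where

  least : ℕ → ℕ
  least zero = zero
  least (suc n) with Q? (least n)
  ... | yes _ = least n
  ... | no _ = suc n

  least-satisfies : ∀ {n y} → y ≤ n → Q y → Q (least n)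
  least-satisfies {zero} z≤n qy = qy
  least-satisfies {suc n} y≤1+n qy with Q? (least n)
  ... | yes q = q
  ... | no ¬q with m≤n⇒m<n∨m≡n y≤1+n
  ...   | inj₁ y<1+n = contradiction (least-satisfies (≤-pred y<1+n) qy) ¬q
  ...   | inj₂ refl = qy

  <least⇒¬ : ∀ {n z} → z < least n → ¬ Q z
  <least⇒¬ {suc n} z< with Q? (least n)
  ... | yes _ = <least⇒¬ {n} z<
  ... | no ¬q = ¬q ∘ least-satisfies {n} (≤-pred z<)

  least-≤ : ∀ {n y} → y ≤ n → Q y → least n ≤ y
  least-≤ {n} y≤n qy = ≮⇒≥ (λ y<least → <least⇒¬ {n} y<least qy)

countPrimes : {R : Pred ℕ 0ℓ} → Decidable R → ℕ → ℕ
countPrimes R? x = length (filter (prime? ∩? R?) (upTo (suc x)))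

module PrimeCounting {R : Pred ℕ 0ℓ} (R? : Decidable R) where

  π : ℕ → ℕ
  π = countPrimes R?

  π-suc : ∀ k → π (suc k) ≡ π k + length (filter (prime? ∩? R?) [ suc k ])
  π-suc k = begin
    length (filter (prime? ∩? R?) (upTo (suc (suc k))))
      ≡⟨ cong (length ∘ filter (prime? ∩? R?)) (upTo-∷ʳ (suc k)) ⟨
    length (filter (prime? ∩? R?) (upTo (suc k) ++ [ suc k ]))
      ≡⟨ cong length (filter-++ (prime? ∩? R?) (upTo (suc k)) [ suc k ]) ⟩
    length (filter (prime? ∩? R?) (upTo (suc k)) ++ filter (prime? ∩? R?) [ suc k ])
      ≡⟨ length-++ (filter (prime? ∩? R?) (upTo (suc k))) ⟩
    π k + length (filter (prime? ∩? R?) [ suc k ]) ∎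
    where open ≡-Reasoning

  π-accept : ∀ {k} → (Prime ∩ R) (suc k) → π (suc k) ≡ suc (π k)
  π-accept {k} p = trans (π-suc k) (trans (cong (λ ps → π k + length ps) (filter-accept (prime? ∩? R?) p)) (+-comm (π k) 1))

  π-reject : ∀ {k} → ¬ (Prime ∩ R) (suc k) → π (suc k) ≡ π k
  π-reject {k} ¬p = trans (π-suc k) (trans (cong (λ ps → π k + length ps) (filter-reject (prime? ∩? R?) ¬p)) (+-identityʳ (π k)))

  π-mono : ∀ {y z} → y ≤ z → π y ≤ π z
  π-mono {z = zero} z≤n = ≤-refl
  π-mono {z = suc z} y≤1+z with m≤n⇒m<n∨m≡n y≤1+z
  ... | inj₁ y<1+z = ≤-trans (π-mono (≤-pred y<1+z)) (≤-trans (m≤m+n (π z) _) (≤-reflexive (sym (π-suc z))))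
  ... | inj₂ refl = ≤-refl

  first-reach : ∀ {r q} → 0 < r → r ≤ π q → (∀ {z} → z < q → ¬ r ≤ π z) → (Prime ∩ R) q × π q ≡ r
  first-reach {q = zero} 0<r r≤0 _ = contradiction (≤-trans 0<r r≤0) λ ()
  first-reach {r} {suc j} _ r≤ before with (prime? ∩? R?) (suc j)
  ... | yes p = p , ≤-antisym (subst (_≤ r) (sym (π-accept p)) (≰⇒> (before ≤-refl))) r≤
  ... | no ¬p = contradiction (subst (r ≤_) (π-reject ¬p) r≤) (before ≤-refl)

  -- the r-th prime in R, provided it does not exceed X
  nth : ℕ → ℕ → ℕ
  nth X r = least (λ y → r ≤? π y) X

  nth-spec : ∀ {X r y} → 0 < r → y ≤ X → r ≤ π y → nth X r ≤ y × (Prime ∩ R) (nth X r) × π (nth X r) ≡ r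
  nth-spec {X} {r} 0<r y≤X r≤πy =
    least-≤ (λ y → r ≤? π y) y≤X r≤πy ,
    first-reach 0<r (least-satisfies (λ y → r ≤? π y) y≤X r≤πy) (<least⇒¬ (λ y → r ≤? π y) {X})

  nth-π : ∀ {X p} → (Prime ∩ R) p → p ≤ X → nth X (π p) ≡ p
  nth-π {p = zero} (() , _)
  nth-π {X} {suc k} p p≤X with nth-spec {X} (subst (0 <_) (sym (π-accept p)) z<s) p≤X ≤-refl
  ... | q≤p , _ , πq≡πp = ≤-antisym q≤p (≮⇒≥ q≮p)
    where
    q≮p : ¬ nth X (π (suc k)) < suc k
    q≮p q<p = <⇒≱ (≤-trans (s≤s (π-mono (≤-pred q<p))) (≤-reflexive (sym (π-accept p)))) (≤-reflexive (sym πq≡πp))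

AllPrimeDivisors : Pred ℕ 0ℓ → ℕ → Set
AllPrimeDivisors R n = ∀ p → Prime p → p ∣ n → R p

primeFactors : (n : ℕ) → .{{NonZero n}} → List ℕ
primeFactors n = PrimeFactorisation.factors (factorise n)

primeFactors-unique : ∀ {as bs} → All Prime as → All Prime bs → product as ≡ product bs → as ↭ bs
primeFactors-unique {as} {bs} as-prime bs-prime Πas≡Πbs = factorisationUnique
  (record { factors = as ; isFactorisation = refl ; factorsPrime = as-prime })
  (record { factors = bs ; isFactorisation = Πas≡Πbs ; factorsPrime = bs-prime })

module PrimeSubstitution {G T : Pred ℕ 0ℓ} (σ τ : ℕ → ℕ)
  (σ-≤ : ∀ {p} → Prime p → G p → σ p ≤ p)
  (σ-prime : ∀ {p} → Prime p → G p → (Prime ∩ T) (σ p))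
  (τ∘σ : ∀ {p} → Prime p → G p → τ (σ p) ≡ p) where

  open PrimeFactorisation using (isFactorisation; factorsPrime)

  σ* : (n : ℕ) → .{{NonZero n}} → ℕ
  σ* n = product (map σ (primeFactors n))

  module _ (n : ℕ) .{{_ : NonZero n}} (G-div : AllPrimeDivisors G n) where

    private
      primeFactors-good : All (Prime ∩ G) (primeFactors n)
      primeFactors-good = All.tabulate λ p∈ →
        let p-prime = All.lookup (factorsPrime (factorise n)) p∈
            p∣n = subst (_ ∣_) (sym (isFactorisation (factorise n))) (∈⇒∣product p∈)
        in p-prime , G-div _ p-prime p∣n

    σ-primeFactors-prime : All Prime (map σ (primeFactors n))
    σ-primeFactors-prime = All.map⁺ (All.map (λ (p-prime , gp) → proj₁ (σ-prime p-prime gp)) primeFactors-good)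

    τ∘σ-primeFactors : map τ (map σ (primeFactors n)) ≡ primeFactors n
    τ∘σ-primeFactors = trans (sym (map-∘ (primeFactors n)))
      (map-id-local (All.map (λ (p-prime , gp) → τ∘σ p-prime gp) primeFactors-good))

    σ*-≤ : σ* n ≤ n
    σ*-≤ = ≤-trans (product-mono primeFactors-good) (≤-reflexive (sym (isFactorisation (factorise n))))
      where
      product-mono : ∀ {qs} → All (Prime ∩ G) qs → product (map σ qs) ≤ product qs
      product-mono [] = ≤-refl
      product-mono ((p-prime , gp) ∷ gs) = *-mono-≤ (σ-≤ p-prime gp) (product-mono gs)

    σ*-nonZero : NonZero (σ* n)
    σ*-nonZero = productOfPrimes≢0 σ-primeFactors-prime

    σ*-divisors : AllPrimeDivisors T (σ* n)
    σ*-divisors q q-prime q∣σ*n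
      with p , p∈ , refl ← ∈-map⁻ σ (factorisationHasAllPrimeFactors q-prime q∣σ*n σ-primeFactors-prime)
      = let (p-prime , gp) = All.lookup primeFactors-good p∈ in proj₂ (σ-prime p-prime gp)

  σ*-injective : ∀ m n .{{_ : NonZero m}} .{{_ : NonZero n}} → AllPrimeDivisors G m → AllPrimeDivisors G n
    → σ* m ≡ σ* n → m ≡ n
  σ*-injective m n G-m G-n σ*m≡σ*n = begin
    m                                           ≡⟨ isFactorisation (factorise m) ⟩
    product (primeFactors m)                    ≡⟨ cong product (τ∘σ-primeFactors m G-m) ⟨
    product (map τ (map σ (primeFactors m)))    ≡⟨ product-↭ (↭.map⁺ τ σ-primeFactors-↭) ⟩
    product (map τ (map σ (primeFactors n)))    ≡⟨ cong product (τ∘σ-primeFactors n G-n) ⟩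
    product (primeFactors n)                    ≡⟨ isFactorisation (factorise n) ⟨
    n                                           ∎
    where
    open ≡-Reasoning
    σ-primeFactors-↭ : map σ (primeFactors m) ↭ map σ (primeFactors n)
    σ-primeFactors-↭ = primeFactors-unique (σ-primeFactors-prime m G-m) (σ-primeFactors-prime n G-n) σ*m≡σ*n

module _ {A B : Pred ℕ 0ℓ} (A? : Decidable A) (B? : Decidable B) (X : ℕ)
  (dominated : ∀ x → x ≤ X → countPrimes B? x ≤ countPrimes A? x) where

  private
    module πA = PrimeCounting A?
    module πB = PrimeCounting B?

    Good : Pred ℕ 0ℓ
    Good p = B p × p ≤ X

    ψ : ℕ → ℕ
    ψ p = πA.nth X (πB.π p)

    χ : ℕ → ℕ
    χ q = πB.nth X (πA.π q)

    ψ-spec : ∀ {p} → Prime p → Good p → ψ p ≤ p × (Prime ∩ A) (ψ p) × πA.π (ψ p) ≡ πB.π p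
    ψ-spec {suc k} p-prime (bp , p≤X) =
      πA.nth-spec (subst (0 <_) (sym (πB.π-accept (p-prime , bp))) z<s) p≤X (dominated _ p≤X)

    χ∘ψ : ∀ {p} → Prime p → Good p → χ (ψ p) ≡ p
    χ∘ψ p-prime g@(bp , p≤X) =
      trans (cong (πB.nth X) (proj₂ (proj₂ (ψ-spec p-prime g)))) (πB.nth-π (p-prime , bp) p≤X)

    open PrimeSubstitution {T = A} ψ χ (λ pr g → proj₁ (ψ-spec pr g)) (λ pr g → proj₁ (proj₂ (ψ-spec pr g))) χ∘ψ

  smooth-count-≤ : (A*? : Decidable (AllPrimeDivisors A ∘ suc)) (B*? : Decidable (AllPrimeDivisors B ∘ suc))
    → ∀ {x} → x ≤ X → length (filter B*? (upTo x)) ≤ length (filter A*? (upTo x))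
  smooth-count-≤ A*? B*? {x} x≤X =
    length-≤-injection h (Unique.filter⁺ B*? (Unique.upTo⁺ x)) h-injective h-into
    where
    h : ℕ → ℕ
    h m = pred (σ* (suc m))

    good-divisors : ∀ {m} → m ∈ filter B*? (upTo x) → AllPrimeDivisors Good (suc m)
    good-divisors m∈ p p-prime p∣ = let (m∈upTo , B-div) = ∈-filter⁻ B*? m∈ in
      B-div p p-prime p∣ , ≤-trans (∣⇒≤ p∣) (≤-trans (∈-upTo⁻ m∈upTo) x≤X)

    suc∘h : ∀ {m} → m ∈ filter B*? (upTo x) → suc (h m) ≡ σ* (suc m)
    suc∘h {m} m∈ = suc-pred _ {{σ*-nonZero (suc m) (good-divisors m∈)}}

    h-injective : ∀ {u v} → u ∈ filter B*? (upTo x) → v ∈ filter B*? (upTo x) → h u ≡ h v → u ≡ v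
    h-injective {u} {v} u∈ v∈ hu≡hv = suc-injective (σ*-injective (suc u) (suc v) (good-divisors u∈) (good-divisors v∈)
      (trans (sym (suc∘h u∈)) (trans (cong suc hu≡hv) (suc∘h v∈))))

    h-into : ∀ {u} → u ∈ filter B*? (upTo x) → h u ∈ filter A*? (upTo x)
    h-into {u} u∈ = ∈-filter⁺ A*?
      (∈-upTo⁺ {x} (≤-trans (≤-reflexive (suc∘h u∈)) (≤-trans (σ*-≤ (suc u) (good-divisors u∈)) (∈-upTo⁻ (proj₁ (∈-filter⁻ B*? u∈))))))
      (subst (AllPrimeDivisors A) (sym (suc∘h u∈)) (σ*-divisors (suc u) (good-divisors u∈)))

module _ (M : Monoid 0ℓ 0ℓ) (e : ℕ → Monoid.Carrier M) where
  open Monoid M hiding (refl; reflexive) renaming (sym to ≈-sym; trans to ≈-trans)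
  open import Relation.Binary.Reasoning.Setoid setoid

  Σ[_] : List ℕ → Carrier
  Σ[ ms ] = foldr (λ m s → e m ∙ s) ε ms

  Σ-upTo-suc : ∀ x → Σ[ upTo (suc x) ] ≈ Σ[ upTo x ] ∙ e x
  Σ-upTo-suc x = begin
    Σ[ upTo (suc x) ]                           ≡⟨ cong Σ[_] (upTo-∷ʳ x) ⟨
    foldr (λ m s → e m ∙ s) ε (upTo x ∷ʳ x)     ≡⟨ foldr-∷ʳ (λ m s → e m ∙ s) ε x (upTo x) ⟩
    foldr (λ m s → e m ∙ s) (e x ∙ ε) (upTo x)  ≈⟨ foldr-from (e x ∙ ε) (upTo x) ⟩
    Σ[ upTo x ] ∙ (e x ∙ ε)                     ≈⟨ ∙-congˡ (identityʳ (e x)) ⟩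
    Σ[ upTo x ] ∙ e x                           ∎
    where
    foldr-from : ∀ t ms → foldr (λ m s → e m ∙ s) t ms ≈ Σ[ ms ] ∙ t
    foldr-from t [] = ≈-sym (identityˡ t)
    foldr-from t (m ∷ ms) = ≈-trans (∙-congˡ (foldr-from t ms)) (≈-sym (assoc (e m) Σ[ ms ] t))

_/1+_ : ℕ → ℕ → ℚ
m /1+ k = + m / suc k

partialSum : (ℕ → ℕ) → ℕ → ℕ
partialSum e x = foldr (λ m s → e m + s) 0 (upTo x)

harmonicSum : (ℕ → ℕ) → ℕ → ℚ
harmonicSum e x = foldr (λ m s → e m /1+ m ℚ.+ s) 0ℚ (upTo x)

partialSum-suc : ∀ e x → partialSum e (suc x) ≡ partialSum e x + e x
partialSum-suc e = Σ-upTo-suc +-0-monoid e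

harmonicSum-suc : ∀ e x → harmonicSum e (suc x) ≡ harmonicSum e x ℚ.+ e x /1+ x
harmonicSum-suc e = Σ-upTo-suc ℚ.+-0-monoid (λ m → e m /1+ m)

toℚᵘ-/1+ : ∀ m k → toℚᵘ (m /1+ k) ℚᵘ.≃ mkℚᵘ (+ m) k
toℚᵘ-/1+ m k = ℚ.toℚᵘ-fromℚᵘ (mkℚᵘ (+ m) k)

/1+-+ : ∀ m n k → m /1+ k ℚ.+ n /1+ k ≡ (m + n) /1+ k
/1+-+ m n k = ℚ.toℚᵘ-injective (begin
  toℚᵘ (m /1+ k ℚ.+ n /1+ k)          ≈⟨ ℚ.toℚᵘ-homo-+ (m /1+ k) (n /1+ k) ⟩
  toℚᵘ (m /1+ k) ℚᵘ.+ toℚᵘ (n /1+ k)  ≈⟨ ℚᵘ.+-cong (toℚᵘ-/1+ m k) (toℚᵘ-/1+ n k) ⟩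
  mkℚᵘ (+ m) k ℚᵘ.+ mkℚᵘ (+ n) k      ≈⟨ *≡* (trans (distrib (+ m) (+ n) (+ suc k))
                                              (cong ((+ m ℤ.+ + n) ℤ.*_) (sym (ℤ.pos-* (suc k) (suc k))))) ⟩
  mkℚᵘ (+ (m + n)) k                   ≈⟨ toℚᵘ-/1+ (m + n) k ⟨
  toℚᵘ ((m + n) /1+ k)                 ∎)
  where
  open ℚᵘ.≃-Reasoning
  distrib : ∀ (m n s : ℤ) → (m ℤ.* s ℤ.+ n ℤ.* s) ℤ.* s ≡ (m ℤ.+ n) ℤ.* (s ℤ.* s)
  distrib = solve-∀

/1+-antitone : ∀ m k → m /1+ suc k ℚ.≤ m /1+ k
/1+-antitone m k = ℚ.toℚᵘ-cancel-≤ (ℚᵘ.≤-respˡ-≃ (ℚᵘ.≃-sym (toℚᵘ-/1+ m (suc k)))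
  (ℚᵘ.≤-respʳ-≃ (ℚᵘ.≃-sym (toℚᵘ-/1+ m k)) (*≤* (ℤ.*-monoˡ-≤-nonNeg (+ m) (+≤+ (n≤1+n (suc k)))))))

/1+-nonNeg : ∀ m k → 0ℚ ℚ.≤ m /1+ k
/1+-nonNeg m k = ℚ.nonNegative⁻¹ (m /1+ k) {{ℚ.normalize-nonNeg m (suc k)}}

module _ (e f : ℕ → ℕ) (X : ℕ) (dominated : ∀ x → x ≤ X → partialSum e x ≤ partialSum f x) where

  slack : ℕ → ℕ
  slack x = partialSum f x ∸ partialSum e x

  private
    slack-suc : ∀ x → suc x ≤ X → e x + slack (suc x) ≡ slack x + f x
    slack-suc x 1+x≤X = +-cancelˡ-≡ (partialSum e x) _ _ (begin
      partialSum e x + (e x + slack (suc x))  ≡⟨ +-assoc (partialSum e x) (e x) _ ⟨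
      partialSum e x + e x + slack (suc x)    ≡⟨ cong (_+ slack (suc x)) (partialSum-suc e x) ⟨
      partialSum e (suc x) + slack (suc x)    ≡⟨ m+[n∸m]≡n (dominated (suc x) 1+x≤X) ⟩
      partialSum f (suc x)                    ≡⟨ partialSum-suc f x ⟩
      partialSum f x + f x                    ≡⟨ cong (_+ f x) (m+[n∸m]≡n (dominated x (≤-trans (n≤1+n x) 1+x≤X))) ⟨
      partialSum e x + slack x + f x          ≡⟨ +-assoc (partialSum e x) (slack x) (f x) ⟩
      partialSum e x + (slack x + f x)        ∎)
      where open ≡-Reasoning

  harmonicSum-slack : ∀ x → x ≤ X → harmonicSum e x ℚ.+ slack x /1+ x ℚ.≤ harmonicSum f x
  harmonicSum-slack zero _ = ℚ.≤-reflexive (trans (ℚ.+-identityˡ _) (ℚ.0/n≡0 1))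
  harmonicSum-slack (suc x) 1+x≤X = begin
    harmonicSum e (suc x) ℚ.+ D′ /1+ suc x            ≡⟨ cong (ℚ._+ D′ /1+ suc x) (harmonicSum-suc e x) ⟩
    (harmonicSum e x ℚ.+ e x /1+ x) ℚ.+ D′ /1+ suc x  ≤⟨ ℚ.+-monoʳ-≤ (harmonicSum e x ℚ.+ e x /1+ x) (/1+-antitone D′ x) ⟩
    (harmonicSum e x ℚ.+ e x /1+ x) ℚ.+ D′ /1+ x      ≡⟨ ℚ.+-assoc (harmonicSum e x) _ _ ⟩
    harmonicSum e x ℚ.+ (e x /1+ x ℚ.+ D′ /1+ x)      ≡⟨ cong (harmonicSum e x ℚ.+_) (/1+-+ (e x) D′ x) ⟩
    harmonicSum e x ℚ.+ (e x + D′) /1+ x              ≡⟨ cong (λ n → harmonicSum e x ℚ.+ n /1+ x) (slack-suc x 1+x≤X) ⟩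
    harmonicSum e x ℚ.+ (D + f x) /1+ x               ≡⟨ cong (harmonicSum e x ℚ.+_) (/1+-+ D (f x) x) ⟨
    harmonicSum e x ℚ.+ (D /1+ x ℚ.+ f x /1+ x)       ≡⟨ ℚ.+-assoc (harmonicSum e x) _ _ ⟨
    (harmonicSum e x ℚ.+ D /1+ x) ℚ.+ f x /1+ x       ≤⟨ ℚ.+-monoˡ-≤ (f x /1+ x) (harmonicSum-slack x x≤X) ⟩
    harmonicSum f x ℚ.+ f x /1+ x                     ≡⟨ harmonicSum-suc f x ⟨
    harmonicSum f (suc x)                              ∎
    where
    open ℚ.≤-Reasoning
    x≤X = ≤-trans (n≤1+n x) 1+x≤X
    D = slack x
    D′ = slack (suc x)

  harmonicSum-mono : ∀ x → x ≤ X → harmonicSum e x ℚ.≤ harmonicSum f x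
  harmonicSum-mono x x≤X = begin
    harmonicSum e x                          ≡⟨ ℚ.+-identityʳ (harmonicSum e x) ⟨
    harmonicSum e x ℚ.+ 0ℚ                   ≤⟨ ℚ.+-monoʳ-≤ (harmonicSum e x) (/1+-nonNeg (slack x) x) ⟩
    harmonicSum e x ℚ.+ slack x /1+ x        ≤⟨ harmonicSum-slack x x≤X ⟩
    harmonicSum f x                          ∎
    where open ℚ.≤-Reasoning

Σg≡length-filter : ∀ d c ms → foldr (λ m s → g d c m + s) 0 ms ≡ length (filter (allPrimeDivisorsCong? d c) ms)
Σg≡length-filter d c [] = refl
Σg≡length-filter d c (m ∷ ms) with allPrimeDivisorsCong? d c m
... | yes gm = trans (cong suc (Σg≡length-filter d c ms)) (sym (cong length (filter-accept (allPrimeDivisorsCong? d c) gm)))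
... | no ¬gm = trans (Σg≡length-filter d c ms) (sym (cong length (filter-reject (allPrimeDivisorsCong? d c) ¬gm)))

corollary1 : (d : ℕ) → 0 < d → (a b : ℤ) → (X : ℕ)
    → (∀ x → x ≤ X → primeCount d b x ≤ primeCount d a x)
    → ∀ x → x ≤ X → (N d b x ≤ N d a x) × (μg d b x ≤ℚ μg d a x)
corollary1 d _ a b X dominated x x≤X = N-≤ x x≤X , harmonicSum-mono (g d b) (g d a) X N-≤ x x≤X
  where
  N-≤ : ∀ x → x ≤ X → N d b x ≤ N d a x
  N-≤ x x≤X = subst₂ _≤_ (sym (Σg≡length-filter d b (upTo x))) (sym (Σg≡length-filter d a (upTo x)))
    (smooth-count-≤ (cong? d a) (cong? d b) X dominated (allPrimeDivisorsCong? d a) (allPrimeDivisorsCong? d b) x≤X)
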